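{- Let $R$ be a directed virtual net and let $\alpha,\beta$ be composable edges of $R$ with $\mathtt{dvr}(\alpha,\beta)=(1,\alpha')$, i.e. the new edge produced by the DVR step on $\alpha,\beta$ pointing to the source of $\alpha$ has weight $1$. Then no further edge $\gamma$ composable with $\alpha$ can give $1$ as residual of the composition with $\alpha$; that is, there is no edge $\gamma\neq\beta$ composable with $\alpha$ such that $\mathtt{dvr}(\alpha,\gamma)=(1,\alpha'')$ for some $\alpha''$.
   Context: Let $\mathsf{L}^*$ be the monoid with a zero, an involution $u\mapsto u^*$ and a monoid morphism $!(\cdot)$, freely generated by $p$, $q$ and a family $(w_i)_i$ subject to $x^*y=\delta_{xy}$ for $x,y\in\{p,q,w_i\}$ and $!(u)w_i=w_i\,!^{e_i}(u)$ for all $u$ ($e_i$ fixed integers). Every nonzero element has a unique stable form $ab^*$ with $a,b$ positive (star-free) monomials. Work in $\mathbb{Z}[\mathsf{L}^*]$ (finite integer linear combinations, star extended linearly); $[b_1,\dots,b_n]=1-\sum_i b_ib_i^*$. Edge weights extend functorially to paths (edge traversed backwards contributes the star of its weight); edges are denoted by their weights. Coincident edges have the same target. $\beta\neq\alpha$ is a counter-edge of $\alpha$ along $\tau$ if $\tau$ is a directed path from the target of $\alpha$ to the target of $\beta$, not ending with $\beta$, with $\alpha\alpha^*(\tau^*\beta)(\tau^*\beta)^*\neq0$. Coincident $\alpha\neq\beta$ are composable if $\alpha\alpha^*\beta\beta^*\ne0$. A virtual net is a weighted directed graph which is split (any three distinct coincident edges $\phi_1,\phi_2,\phi_3$ satisfy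 $\phi_1\phi_1^*\phi_2\phi_2^*\phi_3\phi_3^*=0$) and square-free ($\phi\phi=0$ for every straight path $\phi$). A directed virtual net is an acyclic virtual net where each edge $\alpha$ has weight $[b_1,\dots,b_n]a$ with $a,b_i$ positive monomials ($\alpha^+=a$; $\tau^+$ is a path weight with filters removed), such that for $i\ne j$ and counter-edges $\beta_1,\beta_2$ of $\alpha$ along $\tau_1,\tau_2$: $b_ib_i^*b_jb_j^*=0$, $b_ib_i^*(\tau_1^*\beta_1^+)(\tau_1^*\beta_1^+)^*=0$, $(\tau_1^*\beta_1^+)(\tau_1^*\beta_1^+)^*(\tau_2^*\beta_2^+)(\tau_2^*\beta_2^+)^*=0$ (for distinct pairs). DVR step on composable $\alpha,\beta$ with weights $[b_1,\dots,b_n]a$, $[a_1,\dots,a_m]b$: with $a'b'^*$ the stable form of $b^*a$, create a new node and new edges from it to the source of $\alpha$ (weight $b'$) and to the source of $\beta$ (weight $a'$); the weights of $\alpha,\beta$ become $[b_1,\dots,b_n,b]a$, $[a_1,\dots,a_m,a]b$. Notation $\mathtt{dvr}(\alpha,\beta)=(\beta',\alpha')$: $\beta'$ is the new edge to the source of $\alpha$ (weight $b'$) and $\alpha'$ the new edge to the source of $\beta$ (weight $a'$). -}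

module Defs where

open import Data.Nat using (ℕ; zero; suc)
open import Data.Integer using (ℤ; +_; -[1+_]) renaming (_+_ to _+ℤ_; _*_ to _*ℤ_)
open import Data.Fin using (Fin)
open import Data.List using (List; []; _∷_; map; _++_; length; lookup; last; cartesianProductWith)
open import Data.Maybe using (Maybe; just; nothing)
open import Data.Product using (Σ; _×_; _,_)
open import Relation.Binary.PropositionalEquality using (_≡_; _≢_)
open import Relation.Nullary using (¬_)
open import Data.Unit using (⊤)

-- The monoid L*, presented by generators and relations.
-- The family (w_i) is indexed by an arbitrary set I, with exponents
-- e : I → ℕ.

data Gen (I : Set) : Set where
  gp gq : Gen I
  gw    : I → Gen I

data Term (I : Set) : Set where
  0ᵗ 1ᵗ : Term I
  gen   : Gen I → Term I
  _·_   : Term I → Term I → Term I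
  _*    : Term I → Term I
  !_    : Term I → Term I

infixl 7 _·_
infix 8 _*
infix 9 !_

!^ : {I : Set} → ℕ → Term I → Term I
!^ zero    u = u
!^ (suc k) u = ! (!^ k u)

module _ {I : Set} (e : I → ℕ) where
  infix 4 _≈_
  data _≈_ : Term I → Term I → Set where
    ≈-refl  : ∀ {u} → u ≈ u
    ≈-sym   : ∀ {u v} → u ≈ v → v ≈ u
    ≈-trans : ∀ {u v w} → u ≈ v → v ≈ w → u ≈ w
    ·-cong  : ∀ {u u' v v'} → u ≈ u' → v ≈ v' → u · v ≈ u' · v'
    *-cong  : ∀ {u v} → u ≈ v → u * ≈ v *
    !-cong  : ∀ {u v} → u ≈ v → ! u ≈ ! v
    ·-assoc : ∀ u v w → (u · v) · w ≈ u · (v · w)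
    ·-idˡ   : ∀ u → 1ᵗ · u ≈ u
    ·-idʳ   : ∀ u → u · 1ᵗ ≈ u
    ·-zeroˡ : ∀ u → 0ᵗ · u ≈ 0ᵗ
    ·-zeroʳ : ∀ u → u · 0ᵗ ≈ 0ᵗ
    *-invol : ∀ u → (u *) * ≈ u
    *-anti  : ∀ u v → (u · v) * ≈ (v *) · (u *)
    !-·     : ∀ u v → ! (u · v) ≈ (! u) · (! v)
    !-1     : ! 1ᵗ ≈ 1ᵗ
    !-0     : ! 0ᵗ ≈ 0ᵗ
    !-*     : ∀ u → ! (u *) ≈ (! u) *
    gen-eq  : ∀ x → (gen x) * · gen x ≈ 1ᵗ
    gen-neq : ∀ x y → x ≢ y → (gen x) * · gen y ≈ 0ᵗ
    !-w     : ∀ u i → (! u) · gen (gw i) ≈ gen (gw i) · !^ (e i) u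

data PTerm (I : Set) : Set where
  1ᵖ   : PTerm I
  genᵖ : Gen I → PTerm I
  _·ᵖ_ : PTerm I → PTerm I → PTerm I
  !ᵖ_  : PTerm I → PTerm I

⌜_⌝ : {I : Set} → PTerm I → Term I
⌜ 1ᵖ ⌝      = 1ᵗ
⌜ genᵖ g ⌝  = gen g
⌜ a ·ᵖ b ⌝  = ⌜ a ⌝ · ⌜ b ⌝
⌜ !ᵖ a ⌝    = ! ⌜ a ⌝

StableForm : {I : Set} (e : I → ℕ) → Term I → PTerm I → PTerm I → Set
StableForm e x a b = (¬ (_≈_ e x 0ᵗ)) × _≈_ e x (⌜ a ⌝ · ⌜ b ⌝ *)

-- Z[L*]: finite formal integer combinations of elements of L*,
-- the zero of L* being identified with the zero of Z[L*].

Lin : Set → Set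
Lin I = List (ℤ × Term I)

module _ {I : Set} where
  0ₗ : Lin I
  0ₗ = []

  mon : Term I → Lin I
  mon t = (+ 1 , t) ∷ []

  1ₗ : Lin I
  1ₗ = mon 1ᵗ

  _+ₗ_ : Lin I → Lin I → Lin I
  _+ₗ_ = _++_

  _·ₗ_ : Lin I → Lin I → Lin I
  xs ·ₗ ys = cartesianProductWith (λ { (k , t) (l , u) → (k *ℤ l , t · u) }) xs ys

  _*ₗ : Lin I → Lin I
  xs *ₗ = map (λ { (k , t) → (k , t *) }) xs

  infixl 7 _·ₗ_
  infixl 6 _+ₗ_
  infix 8 _*ₗ

  filt : List (PTerm I) → Lin I
  filt bs = (+ 1 , 1ᵗ) ∷ map (λ b → (-[1+ 0 ] , ⌜ b ⌝ · ⌜ b ⌝ *)) bs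

module _ {I : Set} (e : I → ℕ) where
  infix 4 _≋_
  data _≋_ : Lin I → Lin I → Set where
    ≋-refl  : ∀ {xs} → xs ≋ xs
    ≋-sym   : ∀ {xs ys} → xs ≋ ys → ys ≋ xs
    ≋-trans : ∀ {xs ys zs} → xs ≋ ys → ys ≋ zs → xs ≋ zs
    ≋-cons  : ∀ {k t xs ys} → xs ≋ ys → (k , t) ∷ xs ≋ (k , t) ∷ ys
    ≋-swap  : ∀ k t l u xs → (k , t) ∷ (l , u) ∷ xs ≋ (l , u) ∷ (k , t) ∷ xs
    ≋-merge : ∀ k l t xs → (k , t) ∷ (l , t) ∷ xs ≋ (k +ℤ l , t) ∷ xs
    ≋-zcoef : ∀ t xs → (+ 0 , t) ∷ xs ≋ xs
    ≋-zmon  : ∀ k xs → (k , 0ᵗ) ∷ xs ≋ xs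
    ≋-mon   : ∀ {k t u xs} → _≈_ e t u → (k , t) ∷ xs ≋ (k , u) ∷ xs

data Dir : Set where
  fwd bwd : Dir

record DNet (I : Set) : Set where
  field
    nodes edges : ℕ
    src tgt     : Fin edges → Fin nodes
    filters     : Fin edges → List (PTerm I)
    pos         : Fin edges → PTerm I

  w : Fin edges → Lin I
  w α = filt (filters α) ·ₗ mon ⌜ pos α ⌝

  data Chain : Fin nodes → List (Fin edges) → Fin nodes → Set where
    [] : ∀ {x} → Chain x [] x
    _∷_ : ∀ {x y es} (α : Fin edges) → src α ≡ x → Chain (tgt α) es y → Chain x (α ∷ es) y

  data Walk : Fin nodes → List (Dir × Fin edges) → Fin nodes → Set where
    [] : ∀ {x} → Walk x [] x
    fwd∷ : ∀ {x y ss} (α : Fin edges) → src α ≡ x → Walk (tgt α) ss y → Walk x ((fwd , α) ∷ ss) y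
    bwd∷ : ∀ {x y ss} (α : Fin edges) → tgt α ≡ x → Walk (src α) ss y → Walk x ((bwd , α) ∷ ss) y

  -- functorial weights (first edge acts first, i.e. is the rightmost factor)
  stepW : Dir × Fin edges → Lin I
  stepW (fwd , α) = w α
  stepW (bwd , α) = w α *ₗ

  walkW : List (Dir × Fin edges) → Lin I
  walkW []       = 1ₗ
  walkW (s ∷ ss) = walkW ss ·ₗ stepW s

  chainW : List (Fin edges) → Lin I
  chainW []       = 1ₗ
  chainW (α ∷ es) = chainW es ·ₗ w α

  Straight : List (Dir × Fin edges) → Set
  Straight [] = ⊤
  Straight (_ ∷ []) = Straight []
  Straight ((fwd , α) ∷ (fwd , β) ∷ ss) = Straight ((fwd , β) ∷ ss)
  Straight ((bwd , α) ∷ (bwd , β) ∷ ss) = Straight ((bwd , β) ∷ ss)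
  Straight ((fwd , α) ∷ (bwd , β) ∷ ss) = α ≢ β × Straight ((bwd , β) ∷ ss)
  Straight ((bwd , α) ∷ (fwd , β) ∷ ss) = α ≢ β × Straight ((fwd , β) ∷ ss)

  proj : Fin edges → Lin I
  proj α = w α ·ₗ w α *ₗ

  τβ : List (Fin edges) → Fin edges → Lin I
  τβ τ β = chainW τ *ₗ ·ₗ w β

  τβ⁺ : List (Fin edges) → Fin edges → Lin I
  τβ⁺ τ β = chainW τ *ₗ ·ₗ mon ⌜ pos β ⌝

  bproj : Fin edges → Lin I
  bproj α = mon (⌜ pos α ⌝ · ⌜ pos α ⌝ *)

module _ {I : Set} (e : I → ℕ) (R : DNet I) where
  open DNet R

  CounterEdge : Fin edges → Fin edges → List (Fin edges) → Set
  CounterEdge α β τ =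
    β ≢ α × Chain (tgt α) τ (tgt β) × last τ ≢ just β
    × ¬ (_≋_ e (proj α ·ₗ (τβ τ β ·ₗ τβ τ β *ₗ)) 0ₗ)

  Composable : Fin edges → Fin edges → Set
  Composable α β = tgt α ≡ tgt β × α ≢ β × ¬ (_≋_ e (proj α ·ₗ proj β) 0ₗ)

  Split : Set
  Split = ∀ φ₁ φ₂ φ₃ → φ₁ ≢ φ₂ → φ₁ ≢ φ₃ → φ₂ ≢ φ₃ → tgt φ₁ ≡ tgt φ₂ → tgt φ₁ ≡ tgt φ₃ →
    _≋_ e (proj φ₁ ·ₗ proj φ₂ ·ₗ proj φ₃) 0ₗ

  SquareFree : Set
  SquareFree = ∀ x s ss → Walk x (s ∷ ss) x → Straight (s ∷ ss) →
    _≋_ e (walkW (s ∷ ss) ·ₗ walkW (s ∷ ss)) 0ₗ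

  Acyclic : Set
  Acyclic = ∀ x α es → ¬ Chain x (α ∷ es) x

  FilterConditions : Set
  FilterConditions = ∀ α → let bs = filters α in
      (∀ (i j : Fin (length bs)) → i ≢ j →
         _≋_ e (mon (⌜ lookup bs i ⌝ · ⌜ lookup bs i ⌝ *) ·ₗ mon (⌜ lookup bs j ⌝ · ⌜ lookup bs j ⌝ *)) 0ₗ)
    × (∀ (i : Fin (length bs)) β τ → CounterEdge α β τ →
         _≋_ e (mon (⌜ lookup bs i ⌝ · ⌜ lookup bs i ⌝ *) ·ₗ (τβ⁺ τ β ·ₗ τβ⁺ τ β *ₗ)) 0ₗ)
    × (∀ β₁ τ₁ β₂ τ₂ → CounterEdge α β₁ τ₁ → CounterEdge α β₂ τ₂ → ¬ (β₁ ≡ β₂ × τ₁ ≡ τ₂) →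
         _≋_ e ((τβ⁺ τ₁ β₁ ·ₗ τβ⁺ τ₁ β₁ *ₗ) ·ₗ (τβ⁺ τ₂ β₂ ·ₗ τβ⁺ τ₂ β₂ *ₗ)) 0ₗ)

  DirectedVirtualNet : Set
  DirectedVirtualNet = Split × SquareFree × Acyclic × FilterConditions

  -- dvr(α,β) = (1, α') : writing a'b'* for the stable form of β⁺* α⁺, b' = 1
  DVRFirstIsOne : Fin edges → Fin edges → Set
  DVRFirstIsOne α β = Σ (PTerm I) λ a' → Σ (PTerm I) λ b' →
    StableForm e (⌜ pos β ⌝ * · ⌜ pos α ⌝) a' b' × _≈_ e ⌜ b' ⌝ 1ᵗ

Fin-edges : {I : Set} → DNet I → Set
Fin-edges R = Fin (DNet.edges R)

{-# OPTIONS --safe #-}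
-- If the residual b' of δ⁺* α⁺ is 1, then δ⁺* α⁺ = a'; in an action of L* by partial
-- injections in which positive monomials are total, this says that α⁺ maps every point into
-- the range of δ⁺.  Were this true for β and for γ, the ranges of β⁺ and γ⁺ would meet and
-- β⁺β⁺*γ⁺γ⁺* would be nonzero.  But edges composable with α are counter-edges of α along the
-- empty path, and for those the filter conditions of a directed virtual net make this product
-- vanish.
--
-- Nonvanishing in ℤ[L*] is witnessed by an action on stacks of cells: finite lists standing
-- for the stack padded with infinitely many blanks (canonical lists, without trailing blank,
-- are the unique representatives).  p and q mark the top cell, wᵢ packs the top eᵢ cells into
-- one, and !u acts as u below an unchanged top cell, which is what makes !(u) wᵢ = wᵢ !^eᵢ(u)
-- hold.  For a fixed stack y, the sum of the coefficients of the monomials defined at y is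
-- invariant under the equations of ℤ[L*]; as definedness is undecidable, it is only computed
-- under double negation.  For β⁺β⁺*γ⁺γ⁺* at y = α⁺(empty stack) this sum is 1, not 0.

module Submission where

open import Defs
open import Data.Nat using (ℕ; zero; suc)
open import Data.Integer using (ℤ; 0ℤ; _+_; _*_)
open import Data.Integer.Properties using (+-assoc; +-identityˡ; *-identityˡ; +-commutativeSemigroup)
open import Algebra.Properties.CommutativeSemigroup +-commutativeSemigroup using (x∙yz≈y∙xz)
open import Data.List using (List; []; _∷_)
open import Data.List.Properties using (∷-injectiveˡ; ∷-injectiveʳ)
open import Data.List.Relation.Binary.Pointwise using (Pointwise; []; _∷_; ++⁺; map⁺)
import Data.List.Relation.Binary.Pointwise as Pointwise
open import Data.Product using (Σ; _×_; _,_; proj₁; proj₂; swap)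
open import Data.Unit using (⊤; tt)
open import Data.Empty using (⊥; ⊥-elim)
open import Effect.Monad using (RawMonad)
open import Level using (0ℓ)
open import Function using (_∘_; id)
open import Function.Bundles using (_⇔_; mk⇔; Equivalence)
open import Function.Construct.Symmetry using (⇔-sym)
open import Function.Construct.Composition using (_⇔-∘_)
open import Relation.Binary.PropositionalEquality
open import Relation.Nullary using (¬_; yes; no)
open import Relation.Nullary.Decidable using (¬¬-excluded-middle)
open import Relation.Nullary.Negation using (¬¬-Monad)

open Equivalence using (to; from)
open RawMonad (¬¬-Monad {0ℓ}) using (pure; _>>=_)

data Cell (I : Set) : Set where
  blank       : Cell I
  markp markq : Cell I → Cell I
  pack        : I → List (Cell I) → Cell I

Stack : Set → Set
Stack I = List (Cell I)

module _ {I : Set} where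

  markp-injective : ∀ {c d : Cell I} → markp c ≡ markp d → c ≡ d
  markp-injective refl = refl

  markq-injective : ∀ {c d : Cell I} → markq c ≡ markq d → c ≡ d
  markq-injective refl = refl

  pack-injective : ∀ {i j : I} {cs ds} → pack i cs ≡ pack j ds → i ≡ j × cs ≡ ds
  pack-injective refl = refl , refl

  top : Stack I → Cell I
  top []      = blank
  top (c ∷ _) = c

  pop : Stack I → Stack I
  pop []      = []
  pop (_ ∷ s) = s

  push : Cell I → Stack I → Stack I
  push blank [] = []
  push c     s  = c ∷ s

  Canonical : Stack I → Set
  Canonical []      = ⊤
  Canonical (c ∷ s) = push c s ≡ c ∷ s × Canonical s

  push-top-pop : ∀ {s} → Canonical s → push (top s) (pop s) ≡ s
  push-top-pop {[]}    _         = refl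
  push-top-pop {_ ∷ _} (eq , _) = eq

  top-push : ∀ c s → top (push c s) ≡ c
  top-push blank      []      = refl
  top-push blank      (_ ∷ _) = refl
  top-push (markp _)  _       = refl
  top-push (markq _)  _       = refl
  top-push (pack _ _) _       = refl

  pop-push : ∀ c s → pop (push c s) ≡ s
  pop-push blank      []      = refl
  pop-push blank      (_ ∷ _) = refl
  pop-push (markp _)  _       = refl
  pop-push (markq _)  _       = refl
  pop-push (pack _ _) _       = refl

  push-canonical : ∀ c {s} → Canonical s → Canonical (push c s)
  push-canonical blank      {[]}    _  = tt
  push-canonical blank      {_ ∷ _} cs = refl , cs
  push-canonical (markp _)  cs         = refl , cs
  push-canonical (markq _)  cs         = refl , cs
  push-canonical (pack _ _) cs         = refl , cs

  pop-canonical : ∀ {s} → Canonical s → Canonical (pop s)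
  pop-canonical {[]}    _        = tt
  pop-canonical {_ ∷ _} (_ , cs) = cs

  canonical-ext : ∀ {s s'} → Canonical s → Canonical s' → top s ≡ top s' → pop s ≡ pop s' → s ≡ s'
  canonical-ext cs cs' t≡t' p≡p' =
    trans (sym (push-top-pop cs)) (trans (cong₂ push t≡t' p≡p') (push-top-pop cs'))

  topN : ℕ → Stack I → List (Cell I)
  topN zero    s = []
  topN (suc n) s = top s ∷ topN n (pop s)

  popN : ℕ → Stack I → Stack I
  popN zero    s = s
  popN (suc n) s = popN n (pop s)

  pushAll : List (Cell I) → Stack I → Stack I
  pushAll []       s = s
  pushAll (c ∷ cs) s = push c (pushAll cs s)

  pushAll-canonical : ∀ cs {s} → Canonical s → Canonical (pushAll cs s)
  pushAll-canonical []       c = c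
  pushAll-canonical (d ∷ cs) c = push-canonical d (pushAll-canonical cs c)

  popN-canonical : ∀ n {s} → Canonical s → Canonical (popN n s)
  popN-canonical zero    c = c
  popN-canonical (suc n) c = popN-canonical n (pop-canonical c)

  topN-pushAll-topN : ∀ n s s' → topN n (pushAll (topN n s) s') ≡ topN n s
  topN-pushAll-topN zero    s s' = refl
  topN-pushAll-topN (suc n) s s' = cong₂ _∷_ (top-push (top s) _)
    (trans (cong (topN n) (pop-push (top s) _)) (topN-pushAll-topN n (pop s) s'))

  popN-pushAll-topN : ∀ n s s' → popN n (pushAll (topN n s) s') ≡ s'
  popN-pushAll-topN zero    s s' = refl
  popN-pushAll-topN (suc n) s s' =
    trans (cong (popN n) (pop-push (top s) _)) (popN-pushAll-topN n (pop s) s')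

  pushAll-topN-popN : ∀ n {s} → Canonical s → pushAll (topN n s) (popN n s) ≡ s
  pushAll-topN-popN zero    c = refl
  pushAll-topN-popN (suc n) c =
    trans (cong (push _) (pushAll-topN-popN n (pop-canonical c))) (push-top-pop c)

module Action {I : Set} (e : I → ℕ) where

  act : Gen I → Stack I → Stack I
  act gp     s = markp (top s) ∷ pop s
  act gq     s = markq (top s) ∷ pop s
  act (gw i) s = pack i (topN (e i) s) ∷ popN (e i) s

  act-canonical : ∀ g {s} → Canonical s → Canonical (act g s)
  act-canonical gp     c = refl , pop-canonical c
  act-canonical gq     c = refl , pop-canonical c
  act-canonical (gw i) c = refl , popN-canonical (e i) c

  act-injective : ∀ g {s s'} → Canonical s → Canonical s' → act g s ≡ act g s' → s ≡ s'
  act-injective gp c c' eq =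
    canonical-ext c c' (markp-injective (∷-injectiveˡ eq)) (∷-injectiveʳ eq)
  act-injective gq c c' eq =
    canonical-ext c c' (markq-injective (∷-injectiveˡ eq)) (∷-injectiveʳ eq)
  act-injective (gw i) {s} {s'} c c' eq = begin
    s                                        ≡⟨ pushAll-topN-popN (e i) c ⟨
    pushAll (topN (e i) s) (popN (e i) s)    ≡⟨ cong₂ pushAll topN≡ (∷-injectiveʳ eq) ⟩
    pushAll (topN (e i) s') (popN (e i) s')  ≡⟨ pushAll-topN-popN (e i) c' ⟩
    s'                                       ∎
    where
    open ≡-Reasoning
    topN≡ : topN (e i) s ≡ topN (e i) s'
    topN≡ = proj₂ (pack-injective (∷-injectiveˡ eq))

  act-disjoint : ∀ g h {s s'} → g ≢ h → act g s ≢ act h s'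
  act-disjoint gp     gp     g≢h _  = g≢h refl
  act-disjoint gq     gq     g≢h _  = g≢h refl
  act-disjoint (gw _) (gw _) g≢h eq = g≢h (cong gw (proj₁ (pack-injective (∷-injectiveˡ eq))))
  act-disjoint gp     gq     _   ()
  act-disjoint gp     (gw _) _   ()
  act-disjoint gq     gp     _   ()
  act-disjoint gq     (gw _) _   ()
  act-disjoint (gw _) gp     _   ()
  act-disjoint (gw _) gq     _   ()

  ⟦_⟧ : Term I → Stack I → Stack I → Set
  ⟦ 0ᵗ ⟧    x z = ⊥
  ⟦ 1ᵗ ⟧    x z = Canonical x × x ≡ z
  ⟦ gen g ⟧ x z = Canonical x × act g x ≡ z
  ⟦ u · v ⟧ x z = Σ (Stack I) λ m → ⟦ v ⟧ x m × ⟦ u ⟧ m z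
  ⟦ u * ⟧   x z = ⟦ u ⟧ z x
  ⟦ ! u ⟧   x z = Canonical x × Canonical z × top x ≡ top z × ⟦ u ⟧ (pop x) (pop z)

  ⟦⟧-canonical : ∀ u {x z} → ⟦ u ⟧ x z → Canonical x × Canonical z
  ⟦⟧-canonical 1ᵗ      (c , refl)        = c , c
  ⟦⟧-canonical (gen g) (c , refl)        = c , act-canonical g c
  ⟦⟧-canonical (u · v) (_ , p , q)       = proj₁ (⟦⟧-canonical v p) , proj₂ (⟦⟧-canonical u q)
  ⟦⟧-canonical (u *)   p                 = let (cx , cz) = ⟦⟧-canonical u p in cz , cx
  ⟦⟧-canonical (! u)   (cx , cz , _ , _) = cx , cz

  ⟦!⟧-push : ∀ u {x m} → Canonical x → ⟦ u ⟧ (pop x) m → ⟦ ! u ⟧ x (push (top x) m)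
  ⟦!⟧-push u {x} cx p = cx , push-canonical (top x) (proj₂ (⟦⟧-canonical u p))
    , sym (top-push (top x) _) , subst (⟦ u ⟧ (pop x)) (sym (pop-push (top x) _)) p

  ⟦!^⟧ : ∀ n u {x z} →
    ⟦ !^ n u ⟧ x z ⇔ (Canonical x × Canonical z × topN n x ≡ topN n z × ⟦ u ⟧ (popN n x) (popN n z))
  ⟦!^⟧ zero    u = mk⇔ (λ p → let (cx , cz) = ⟦⟧-canonical u p in cx , cz , refl , p)
                       (proj₂ ∘ proj₂ ∘ proj₂)
  ⟦!^⟧ (suc n) u = mk⇔
    (λ (cx , cz , t≡t' , p) → let (_ , _ , ts≡ts' , q) = to (⟦!^⟧ n u) p in
      cx , cz , cong₂ _∷_ t≡t' ts≡ts' , q)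
    (λ (cx , cz , ts≡ts' , q) → cx , cz , ∷-injectiveˡ ts≡ts'
      , from (⟦!^⟧ n u) (pop-canonical cx , pop-canonical cz , ∷-injectiveʳ ts≡ts' , q))

  !-·-sound : ∀ u v {x z} → ⟦ ! (u · v) ⟧ x z ⇔ ⟦ ! u · ! v ⟧ x z
  !-·-sound u v {x} {z} = mk⇔
    (λ (cx , cz , top≡ , m , p , q) →
      push (top x) m , ⟦!⟧-push v cx p
      , ( push-canonical (top x) (proj₂ (⟦⟧-canonical v p)) , cz , trans (top-push (top x) m) top≡
        , subst (λ s → ⟦ u ⟧ s (pop z)) (sym (pop-push (top x) m)) q))
    (λ (m , (cx , _ , top≡ , p) , (_ , cz , top≡' , q)) → cx , cz , trans top≡ top≡' , pop m , p , q)

  !-w-sound : ∀ u i {x z} → ⟦ ! u · gen (gw i) ⟧ x z ⇔ ⟦ gen (gw i) · !^ (e i) u ⟧ x z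
  !-w-sound u i {x} {z} = mk⇔
    (λ { (_ , (cx , refl) , (_ , cz , top≡ , p)) →
      let M  = pushAll (topN (e i) x) (pop z)
          cM = pushAll-canonical (topN (e i) x) (pop-canonical cz)
          topN≡ = topN-pushAll-topN (e i) x (pop z)
          popN≡ = popN-pushAll-topN (e i) x (pop z)
      in M , from (⟦!^⟧ (e i) u) (cx , cM , sym topN≡ , subst (⟦ u ⟧ (popN (e i) x)) (sym popN≡) p)
           , (cM , trans (cong₂ (λ cs s → pack i cs ∷ s) topN≡ popN≡)
                         (trans (cong (λ c → push c (pop z)) top≡) (push-top-pop cz))) })
    (λ { (_ , p , (cM , refl)) → let (cx , _ , topN≡ , q) = to (⟦!^⟧ (e i) u) p in
      _ , (cx , refl) , (act-canonical (gw i) cx , act-canonical (gw i) cM , cong (pack i) topN≡ , q) })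

  ⟦⟧-resp-≈ : ∀ {u v} → _≈_ e u v → ∀ {x z} → ⟦ u ⟧ x z ⇔ ⟦ v ⟧ x z
  ⟦⟧-resp-≈ ≈-refl        = mk⇔ id id
  ⟦⟧-resp-≈ (≈-sym q)     = ⇔-sym (⟦⟧-resp-≈ q)
  ⟦⟧-resp-≈ (≈-trans q r) = ⟦⟧-resp-≈ r ⇔-∘ ⟦⟧-resp-≈ q
  ⟦⟧-resp-≈ (·-cong q r)  = mk⇔ (λ (m , p , p') → m , to (⟦⟧-resp-≈ r) p , to (⟦⟧-resp-≈ q) p')
                                (λ (m , p , p') → m , from (⟦⟧-resp-≈ r) p , from (⟦⟧-resp-≈ q) p')
  ⟦⟧-resp-≈ (*-cong q)    = ⟦⟧-resp-≈ q
  ⟦⟧-resp-≈ (!-cong q)    = mk⇔ (λ (cx , cz , top≡ , p) → cx , cz , top≡ , to (⟦⟧-resp-≈ q) p)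
                                (λ (cx , cz , top≡ , p) → cx , cz , top≡ , from (⟦⟧-resp-≈ q) p)
  ⟦⟧-resp-≈ (·-assoc _ _ _) = mk⇔ (λ (m , r , (n , q , p)) → n , (m , r , q) , p)
                                  (λ (n , (m , r , q) , p) → m , r , (n , q , p))
  ⟦⟧-resp-≈ (·-idˡ u)     = mk⇔ (λ { (_ , p , (_ , refl)) → p })
                                (λ p → _ , p , proj₂ (⟦⟧-canonical u p) , refl)
  ⟦⟧-resp-≈ (·-idʳ u)     = mk⇔ (λ { (_ , (_ , refl) , p) → p })
                                (λ p → _ , (proj₁ (⟦⟧-canonical u p) , refl) , p)
  ⟦⟧-resp-≈ (·-zeroˡ _)   = mk⇔ (λ ()) (λ ())
  ⟦⟧-resp-≈ (·-zeroʳ _)   = mk⇔ (λ ()) (λ ())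
  ⟦⟧-resp-≈ (*-invol _)   = mk⇔ id id
  ⟦⟧-resp-≈ (*-anti _ _)  = mk⇔ (λ (m , p , q) → m , q , p) (λ (m , p , q) → m , q , p)
  ⟦⟧-resp-≈ (!-· u v)     = !-·-sound u v
  ⟦⟧-resp-≈ !-1           = mk⇔ (λ (cx , cz , top≡ , _ , pop≡) → cx , canonical-ext cx cz top≡ pop≡)
                                (λ { (cx , refl) → cx , cx , refl , pop-canonical cx , refl })
  ⟦⟧-resp-≈ !-0           = mk⇔ (λ ()) (λ ())
  ⟦⟧-resp-≈ (!-* _)       = mk⇔ (λ (cx , cz , top≡ , p) → cz , cx , sym top≡ , p)
                                (λ (cx , cz , top≡ , p) → cz , cx , sym top≡ , p)
  ⟦⟧-resp-≈ (gen-eq g)    =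
    mk⇔ (λ (_ , (cx , p) , (cz , q)) → cx , act-injective g cx cz (trans p (sym q)))
        (λ { (cx , refl) → _ , (cx , refl) , (cx , refl) })
  ⟦⟧-resp-≈ (gen-neq g h g≢h) =
    mk⇔ (λ (_ , (_ , p) , (_ , q)) → act-disjoint g h g≢h (trans q (sym p))) (λ ())
  ⟦⟧-resp-≈ (!-w u i)     = !-w-sound u i

  ⟦_⟧⁺ : PTerm I → Stack I → Stack I
  ⟦ 1ᵖ ⟧⁺      x = x
  ⟦ genᵖ g ⟧⁺  x = act g x
  ⟦ a ·ᵖ b ⟧⁺  x = ⟦ a ⟧⁺ (⟦ b ⟧⁺ x)
  ⟦ !ᵖ a ⟧⁺    x = push (top x) (⟦ a ⟧⁺ (pop x))

  positive-total : ∀ a {x} → Canonical x → ⟦ ⌜ a ⌝ ⟧ x (⟦ a ⟧⁺ x)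
  positive-total 1ᵖ       c = c , refl
  positive-total (genᵖ g) c = c , refl
  positive-total (a ·ᵖ b) c =
    let p = positive-total b c in _ , p , positive-total a (proj₂ (⟦⟧-canonical ⌜ b ⌝ p))
  positive-total (!ᵖ a)   c = ⟦!⟧-push ⌜ a ⌝ c (positive-total a (pop-canonical c))

  positive-functional : ∀ a {x z} → ⟦ ⌜ a ⌝ ⟧ x z → ⟦ a ⟧⁺ x ≡ z
  positive-functional 1ᵖ       (_ , x≡z) = x≡z
  positive-functional (genᵖ g) (_ , x≡z) = x≡z
  positive-functional (a ·ᵖ b) (_ , p , q) =
    trans (cong ⟦ a ⟧⁺ (positive-functional b p)) (positive-functional a q)
  positive-functional (!ᵖ a) (_ , cz , top≡ , p) =
    trans (cong₂ push top≡ (positive-functional a p)) (push-top-pop cz)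

  record Defined (y : Stack I) (t : Term I) : Set where
    constructor defined
    field
      {image}  : Stack I
      image-of : ⟦ t ⟧ y image

  record InRange (t : Term I) (y : Stack I) : Set where
    constructor inRange
    field
      {preimage}  : Stack I
      preimage-of : ⟦ t ⟧ preimage y

  residual-one⇒inRange : ∀ {a b c b' x} → _≈_ e (⌜ b ⌝ * · ⌜ a ⌝) (⌜ c ⌝ · ⌜ b' ⌝ *) →
    _≈_ e ⌜ b' ⌝ 1ᵗ → Canonical x → InRange ⌜ b ⌝ (⟦ a ⟧⁺ x)
  residual-one⇒inRange {a} {b} {c} {x = x} b*a≈cb'* b'≈1 cx =
    let ⟦b'⟧xx = from (⟦⟧-resp-≈ b'≈1) (cx , refl)
        (_ , ⟦a⟧xm , ⟦b⟧cm) = from (⟦⟧-resp-≈ b*a≈cb'*) (x , ⟦b'⟧xx , positive-total c cx)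
    in inRange (subst (⟦ ⌜ b ⌝ ⟧ (⟦ c ⟧⁺ x)) (sym (positive-functional a ⟦a⟧xm)) ⟦b⟧cm)

  inRange-1*· : ∀ {u y} → InRange u y → InRange (1ᵗ * · u) y
  inRange-1*· {u} (inRange p) = inRange (_ , p , proj₂ (⟦⟧-canonical u p) , refl)

  ranges-meet⇒defined : ∀ {u v y} → InRange u y → InRange v y → Defined y ((u · u *) · (v · v *))
  ranges-meet⇒defined (inRange p) (inRange q) = defined (_ , (_ , q , q) , (_ , p , p))

  module _ (y : Stack I) where

    data Counts : Lin I → ℤ → Set where
      []         : Counts [] 0ℤ
      defined∷   : ∀ {k t xs n} → Defined y t → Counts xs n → Counts ((k , t) ∷ xs) (k + n)
      undefined∷ : ∀ {k t xs n} → ¬ Defined y t → Counts xs n → Counts ((k , t) ∷ xs) n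

    _⇛_ : Lin I → Lin I → Set
    xs ⇛ ys = ∀ {n} → Counts xs n → ¬ ¬ Counts ys n

    ∷-⇛ : ∀ {m xs ys} → xs ⇛ ys → (m ∷ xs) ⇛ (m ∷ ys)
    ∷-⇛ xs⇛ys (defined∷ d c)   = xs⇛ys c >>= pure ∘ defined∷ d
    ∷-⇛ xs⇛ys (undefined∷ d c) = xs⇛ys c >>= pure ∘ undefined∷ d

    swap-⇛ : ∀ {k t l u xs} → ((k , t) ∷ (l , u) ∷ xs) ⇛ ((l , u) ∷ (k , t) ∷ xs)
    swap-⇛ {k} {l = l} (defined∷ d (defined∷ d' c)) =
      pure (subst (Counts _) (x∙yz≈y∙xz l k _) (defined∷ d' (defined∷ d c)))
    swap-⇛ (defined∷ d (undefined∷ d' c))   = pure (undefined∷ d' (defined∷ d c))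
    swap-⇛ (undefined∷ d (defined∷ d' c))   = pure (defined∷ d' (undefined∷ d c))
    swap-⇛ (undefined∷ d (undefined∷ d' c)) = pure (undefined∷ d' (undefined∷ d c))

    ≈-⇛ : ∀ {k t u xs} → _≈_ e t u → ((k , t) ∷ xs) ⇛ ((k , u) ∷ xs)
    ≈-⇛ t≈u (defined∷ (defined p) c) = pure (defined∷ (defined (to (⟦⟧-resp-≈ t≈u) p)) c)
    ≈-⇛ t≈u (undefined∷ d c)         =
      pure (undefined∷ (λ (defined p) → d (defined (from (⟦⟧-resp-≈ t≈u) p))) c)

    ≋⇒⇛ : ∀ {xs ys} → _≋_ e xs ys → (xs ⇛ ys) × (ys ⇛ xs)
    ≋⇒⇛ ≋-refl        = pure , pure
    ≋⇒⇛ (≋-sym q)     = swap (≋⇒⇛ q)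
    ≋⇒⇛ (≋-trans q r) = (λ c → proj₁ (≋⇒⇛ q) c >>= proj₁ (≋⇒⇛ r))
                      , (λ c → proj₂ (≋⇒⇛ r) c >>= proj₂ (≋⇒⇛ q))
    ≋⇒⇛ (≋-cons q)    = ∷-⇛ (proj₁ (≋⇒⇛ q)) , ∷-⇛ (proj₂ (≋⇒⇛ q))
    ≋⇒⇛ (≋-swap _ _ _ _ _) = swap-⇛ , swap-⇛
    ≋⇒⇛ (≋-merge k l _ _) =
      (λ { (defined∷ d (defined∷ _ c))    → pure (subst (Counts _) (+-assoc k l _) (defined∷ d c))
         ; (defined∷ d (undefined∷ d' _)) → ⊥-elim (d' d)
         ; (undefined∷ d (defined∷ d' _)) → ⊥-elim (d d')
         ; (undefined∷ d (undefined∷ _ c)) → pure (undefined∷ d c) })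
      , (λ { (defined∷ d c)   → pure (subst (Counts _) (sym (+-assoc k l _)) (defined∷ d (defined∷ d c)))
           ; (undefined∷ d c) → pure (undefined∷ d (undefined∷ d c)) })
    ≋⇒⇛ (≋-zcoef _ _) =
      (λ { (defined∷ _ c)   → pure (subst (Counts _) (sym (+-identityˡ _)) c)
         ; (undefined∷ _ c) → pure c })
      , (λ {n} c → ¬¬-excluded-middle >>= λ
           { (yes d) → pure (subst (Counts _) (+-identityˡ n) (defined∷ d c))
           ; (no ¬d) → pure (undefined∷ ¬d c) })
    ≋⇒⇛ (≋-zmon _ _)   = (λ { (defined∷ (defined ()) _) ; (undefined∷ _ c) → pure c })
                       , (λ c → pure (undefined∷ (λ { (defined ()) }) c))
    ≋⇒⇛ (≋-mon t≈u)    = ≈-⇛ t≈u , ≈-⇛ (≈-sym t≈u)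

  defined⇒mon≉0 : ∀ {y t} → Defined y t → ¬ (_≋_ e (mon t) 0ₗ)
  defined⇒mon≉0 d t≋0 = proj₁ (≋⇒⇛ _ t≋0) (defined∷ d []) (λ ())

module _ {I : Set} (e : I → ℕ) where

  MonomialEq : ℤ × Term I → ℤ × Term I → Set
  MonomialEq (k , t) (l , u) = k ≡ l × _≈_ e t u

  Termwise : Lin I → Lin I → Set
  Termwise = Pointwise MonomialEq

  termwise⇒≋ : ∀ {xs ys} → Termwise xs ys → _≋_ e xs ys
  termwise⇒≋ []                   = ≋-refl
  termwise⇒≋ ((refl , t≈u) ∷ xs≈ys) = ≋-trans (≋-mon t≈u) (≋-cons (termwise⇒≋ xs≈ys))

  termwise-refl : ∀ xs → Termwise xs xs
  termwise-refl _ = Pointwise.refl (refl , ≈-refl)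

  ·ₗ-termwise : ∀ {xs xs' ys ys'} → Termwise xs xs' → Termwise ys ys' →
    Termwise (xs ·ₗ ys) (xs' ·ₗ ys')
  ·ₗ-termwise []              _      = []
  ·ₗ-termwise (x≈x' ∷ xs≈xs') ys≈ys' =
    ++⁺ (map⁺ _ _ (Pointwise.map (monomial-· x≈x') ys≈ys')) (·ₗ-termwise xs≈xs' ys≈ys')
    where
    monomial-· : ∀ {k l t u k' l' t' u'} → MonomialEq (k , t) (l , u) →
      MonomialEq (k' , t') (l' , u') → MonomialEq (k * k' , t · t') (l * l' , u · u')
    monomial-· (k≡l , t≈u) (k'≡l' , t'≈u') = cong₂ _*_ k≡l k'≡l' , ·-cong t≈u t'≈u'

  *ₗ-termwise : ∀ {xs ys} → Termwise xs ys → Termwise (xs *ₗ) (ys *ₗ)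
  *ₗ-termwise = map⁺ _ _ ∘ Pointwise.map (λ (k≡l , t≈u) → k≡l , *-cong t≈u)

  1*≈1 : _≈_ e (1ᵗ *) 1ᵗ
  1*≈1 = ≈-trans (≈-sym (·-idʳ (1ᵗ *)))
         (≈-trans (·-cong ≈-refl (≈-sym (*-invol 1ᵗ)))
         (≈-trans (≈-sym (*-anti (1ᵗ *) 1ᵗ))
         (≈-trans (*-cong (·-idʳ (1ᵗ *)))
                  (*-invol 1ᵗ))))

  1*·ₗ-termwise : ∀ xs → Termwise (mon (1ᵗ *) ·ₗ xs) xs
  1*·ₗ-termwise []             = []
  1*·ₗ-termwise ((k , t) ∷ xs) =
    (*-identityˡ k , ≈-trans (·-cong 1*≈1 ≈-refl) (·-idˡ t)) ∷ 1*·ₗ-termwise xs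

module _ {I : Set} (e : I → ℕ) (R : DNet I) where
  open DNet R
  open Action e

  composable⇒counterEdge : ∀ {α δ} → Composable e R α δ → CounterEdge e R α δ []
  composable⇒counterEdge {α} {δ} (tgtα≡tgtδ , α≢δ , αδ≉0) =
    α≢δ ∘ sym , subst (Chain (tgt α) []) tgtα≡tgtδ [] , (λ ()) , αδ≉0 ∘ ≋-trans (≋-sym emptyPath)
    where
    emptyPath : _≋_ e (proj α ·ₗ (τβ [] δ ·ₗ τβ [] δ *ₗ)) (proj α ·ₗ proj δ)
    emptyPath = termwise⇒≋ e (·ₗ-termwise e (termwise-refl e (proj α))
      (·ₗ-termwise e (1*·ₗ-termwise e (w δ)) (*ₗ-termwise e (1*·ₗ-termwise e (w δ)))))

  dvrFirstIsOne⇒inRange : ∀ α δ → DVRFirstIsOne e R α δ → InRange ⌜ pos δ ⌝ (⟦ pos α ⟧⁺ [])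
  dvrFirstIsOne⇒inRange _ _ (_ , _ , (_ , δ⁺*α⁺≈a'b'*) , b'≈1) =
    residual-one⇒inRange δ⁺*α⁺≈a'b'* b'≈1 tt

mainTheorem5 : (I : Set) (e : I → ℕ) (R : DNet I) → DirectedVirtualNet e R →
    (α β : Fin-edges R) → Composable e R α β → DVRFirstIsOne e R α β →
    ¬ (Σ (Fin-edges R) λ γ → γ ≢ β × Composable e R α γ × DVRFirstIsOne e R α γ)
mainTheorem5 _ e R (_ , _ , _ , filterConditions) α β α∼β dvrβ (γ , γ≢β , α∼γ , dvrγ) =
  defined⇒mon≉0 (ranges-meet⇒defined (inRange-1*· (dvrFirstIsOne⇒inRange e R α β dvrβ))
                                     (inRange-1*· (dvrFirstIsOne⇒inRange e R α γ dvrγ)))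
                rangesDisjoint
  where
  open DNet R
  open Action e
  rangesDisjoint : _≋_ e ((τβ⁺ [] β ·ₗ τβ⁺ [] β *ₗ) ·ₗ (τβ⁺ [] γ ·ₗ τβ⁺ [] γ *ₗ)) 0ₗ
  rangesDisjoint = proj₂ (proj₂ (filterConditions α)) β [] γ []
    (composable⇒counterEdge e R α∼β) (composable⇒counterEdge e R α∼γ) (γ≢β ∘ sym ∘ proj₁)
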